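{- Let $n \geq 4$ be even. Then there exists an $SMA(5,n)$ such that for every $x \in \{1, 2, 3, \ldots, 5n/2\}$ the entries $x$ and $-x$ appear in the same row.
   Context: For positive integers $m,n$ with $mn$ even, a (tight) signed magic array $SMA(m,n)$ is an $m \times n$ array with no empty cells whose entries are the elements of $X=\{\pm 1, \pm 2, \ldots, \pm mn/2\}$, each element of $X$ appearing exactly once, such that the entries of every row and of every column sum to $0$. -}

module Defs where

open import Data.Nat using (ℕ; _*_; _/_; _≤_; _<_; suc)
open import Data.Integer using (ℤ; +_; -_; ∣_∣; 0ℤ)
open import Data.Fin using (Fin)
open import Data.Product using (_×_; _,_; Σ; ∃; ∃-syntax)
open import Relation.Binary.PropositionalEquality using (_≡_; _≢_)
open import Function.Definitions using (Injective)
open import Data.Vec.Functional using (foldr)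
import Data.Integer as ℤ

Array : ℕ → ℕ → Set
Array m n = Fin m → Fin n → ℤ

sumℤ : ∀ {k} → (Fin k → ℤ) → ℤ
sumℤ v = foldr ℤ._+_ 0ℤ v

InX : ℕ → ℤ → Set
InX N z = (z ≢ 0ℤ) × (∣ z ∣ ≤ N)

-- Tight signed magic array SMA(m,n) (requires m*n even; entry set X with N = mn/2).
record IsSMA (m n : ℕ) (A : Array m n) : Set where
  field
    entries-in-X : ∀ i j → InX ((m * n) / 2) (A i j)
    each-once    : Injective _≡_ _≡_ (λ (p : Fin m × Fin n) → A (Data.Product.proj₁ p) (Data.Product.proj₂ p))
    all-appear   : ∀ z → InX ((m * n) / 2) z → ∃[ i ] ∃[ j ] A i j ≡ z
    row-sums     : ∀ i → sumℤ (λ j → A i j) ≡ 0ℤ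
    col-sums     : ∀ j → sumℤ (λ i → A i j) ≡ 0ℤ

{-# OPTIONS --safe #-}
-- Every row is built from pairs {x, −x}, so row sums vanish by themselves; and once each
-- x ∈ [1, N] (N = 5n/2) has its pair in some row, the 5n = 2N cells hold distinct elements
-- of X by counting. For n = 4M + 4 the array is M + 1 blocks of four columns, block t
-- following one pattern with parameters i = t and j = M − t whose magnitudes have the form
-- o + i, o + 2i or o + j. Each row of a block consists of two pairs ±x, ±y; each column sums
-- to zero because the offsets o satisfy four linear relations and i + j = M; and as t runs
-- over the blocks these magnitudes tile [1, N] by intervals of length M + 1 or 2M + 2.
-- For n = 4M + 6 the offsets leave five gaps in [1, N]; they are filled by two extra
-- columns, which also take three entries of the last block to keep its columns balanced.
module Submission where

open import Defs
import Algebra.Properties.Monoid.Sum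
open import Data.Empty using (⊥-elim)
open import Data.Fin as Fin using (Fin; zero; suc; toℕ; _↑ˡ_; _↑ʳ_; splitAt; combine; remQuot)
import Data.Fin.Properties as Finₚ
open import Data.Fin.Patterns using (0F; 1F; 2F; 3F; 4F; 5F)
open import Data.Integer as ℤ using (ℤ; +_; -_; 0ℤ; _⊖_)
import Data.Integer.Properties as ℤₚ
open import Data.List using ([]; _∷_)
open import Data.Nat as ℕ using (ℕ; zero; suc; _+_; _*_; _∸_; _/_; _≤_; _<_; z≤n; s≤s)
open import Data.Nat.Divisibility using (_∣_; divides)
open import Data.Nat.DivMod using (m*n/n≡m)
import Data.Nat.Properties as ℕₚ
open import Data.Nat.Tactic.RingSolver using (solve; solve-∀)
open import Data.Product using (_×_; _,_; ∃; ∃-syntax; proj₁; proj₂; uncurry)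
open import Data.Sign.Base as Sign using (Sign)
open import Data.Sum using (_⊎_; inj₁; inj₂; [_,_]′)
open import Data.Vec.Functional using (foldr)
open import Function using (_∘_; _∋_)
open import Function.Definitions using (Injective)
open import Relation.Binary.PropositionalEquality
  using (_≡_; refl; sym; trans; cong; cong₂; subst; module ≡-Reasoning)
open import Relation.Nullary using (yes; no; contradiction)

open ≡-Reasoning

-- Sign and magnitude rather than ℤ: the positive and negative parts of a symbolic entry
-- then compute, turning a vanishing sum into an equation Σ⁺ ≡ Σ⁻ in ℕ.
Entry : Set
Entry = Sign × ℕ

infix 8 ⊕_ ⊖_

⊕_ ⊖_ : ℕ → Entry
⊕ x = Sign.+ , x
⊖ x = Sign.- , x

⟦_⟧ : Entry → ℤ
⟦ Sign.+ , x ⟧ = + x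
⟦ Sign.- , x ⟧ = - (+ x)

positive negative : Entry → ℕ
positive (Sign.+ , x) = x
positive (Sign.- , _) = 0
negative (Sign.+ , _) = 0
negative (Sign.- , x) = x

Σ⁺ Σ⁻ : ∀ {k} → (Fin k → Entry) → ℕ
Σ⁺ v = foldr _+_ 0 (positive ∘ v)
Σ⁻ v = foldr _+_ 0 (negative ∘ v)

Balanced : ∀ {k} → (Fin k → Entry) → Set
Balanced v = Σ⁺ v ≡ Σ⁻ v

sumℤ-⟦⟧ : ∀ {k} (v : Fin k → Entry) → sumℤ (⟦_⟧ ∘ v) ≡ Σ⁺ v ⊖ Σ⁻ v
sumℤ-⟦⟧ {zero} v = refl
sumℤ-⟦⟧ {suc k} v = trans (cong (λ s → ⟦ v zero ⟧ ℤ.+ s) (sumℤ-⟦⟧ (v ∘ suc))) (step (v zero))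
  where
  step : ∀ x → ⟦ x ⟧ ℤ.+ (Σ⁺ (v ∘ suc) ⊖ Σ⁻ (v ∘ suc))
               ≡ (positive x + Σ⁺ (v ∘ suc)) ⊖ (negative x + Σ⁻ (v ∘ suc))
  step (Sign.+ , x)     = ℤₚ.distribʳ-⊖-+-pos x (Σ⁺ (v ∘ suc)) (Σ⁻ (v ∘ suc))
  step (Sign.- , zero)  = ℤₚ.+-identityˡ _
  step (Sign.- , suc x) = ℤₚ.distribʳ-⊖-+-neg x (Σ⁺ (v ∘ suc)) (Σ⁻ (v ∘ suc))

balanced⇒sumℤ≡0 : ∀ {k} {v : Fin k → Entry} → Balanced v → sumℤ (⟦_⟧ ∘ v) ≡ 0ℤ
balanced⇒sumℤ≡0 {v = v} balanced =
  trans (sumℤ-⟦⟧ v) (trans (cong (_⊖ Σ⁻ v) balanced) (ℤₚ.n⊖n≡0 (Σ⁻ v)))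

open Algebra.Properties.Monoid.Sum ℤₚ.+-0-monoid using (sum-cong-≗; sum-replicate-zero)

sumℤ-↑ : ∀ m {k} (f : Fin (m + k) → ℤ) →
  sumℤ f ≡ sumℤ (λ c → f (c ↑ˡ k)) ℤ.+ sumℤ (λ e → f (m ↑ʳ e))
sumℤ-↑ zero f = sym (ℤₚ.+-identityˡ _)
sumℤ-↑ (suc m) f =
  trans (cong (λ s → f zero ℤ.+ s) (sumℤ-↑ m (f ∘ suc))) (sym (ℤₚ.+-assoc (f zero) _ _))

sumℤ-combine : ∀ m {n} (f : Fin (m * n) → ℤ) →
  sumℤ f ≡ sumℤ (λ (t : Fin m) → sumℤ (λ (q : Fin n) → f (combine t q)))
sumℤ-combine zero f = refl
sumℤ-combine (suc m) {n} f = trans (sumℤ-↑ n {m * n} f)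
  (cong (λ s → sumℤ (λ q → f (q ↑ˡ (m * n))) ℤ.+ s) (sumℤ-combine m (λ c → f (n ↑ʳ c))))

injective⇒surjective : ∀ {n} (f : Fin n → Fin n) → Injective _≡_ _≡_ f → ∀ y → ∃ λ x → f x ≡ y
injective⇒surjective {zero} f _ ()
injective⇒surjective {suc n} f f-injective y with Finₚ.any? (λ x → f x Finₚ.≟ y)
... | yes hit = hit
... | no miss = ⊥-elim (ℕₚ.<-irrefl refl (Finₚ.injective⇒≤ squeeze-injective))
  where
  squeeze : Fin (suc n) → Fin n
  squeeze x = Fin.punchOut (miss ∘ (x ,_) ∘ sym)
  squeeze-injective : Injective _≡_ _≡_ squeeze
  squeeze-injective {x} {x′} eq =
    f-injective (Finₚ.punchOut-injective (miss ∘ (x ,_) ∘ sym) (miss ∘ (x′ ,_) ∘ sym) eq)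

Paired : ∀ {m n} → Array m n → ℕ → Set
Paired A x = ∃[ i ] ((∃[ j ] A i j ≡ + x) × (∃[ k ] A i k ≡ - (+ x)))

Holds-on : (ℕ → Set) → ℕ → ℕ → Set
Holds-on P lo hi = ∀ x → lo ≤ x → x < hi → P x

AllPaired : ∀ {m n} → Array m n → ℕ → Set
AllPaired A N = Holds-on (Paired A) 1 (suc N)

module Pigeonhole {m n N : ℕ} (A : Array m n) (size : m * n ≡ N + N) (paired : AllPaired A N) where

  element : Fin N ⊎ Fin N → ℤ
  element (inj₁ a) = + suc (toℕ a)
  element (inj₂ a) = - (+ suc (toℕ a))

  element-injective : Injective _≡_ _≡_ element
  element-injective {inj₁ a} {inj₁ b} eq = cong inj₁ (Finₚ.toℕ-injective (ℕₚ.suc-injective (ℤₚ.+-injective eq)))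
  element-injective {inj₂ a} {inj₂ b} eq =
    cong inj₂ (Finₚ.toℕ-injective (ℕₚ.suc-injective (ℤₚ.+-injective (ℤₚ.neg-injective eq))))
  element-injective {inj₁ _} {inj₂ _} ()
  element-injective {inj₂ _} {inj₁ _} ()

  element-in-X : ∀ v → InX N (element v)
  element-in-X (inj₁ a) = (λ ()) , Finₚ.toℕ<n a
  element-in-X (inj₂ a) = (λ ()) , Finₚ.toℕ<n a

  entry : Fin m × Fin n → ℤ
  entry (i , j) = A i j

  location : ∀ v → ∃ λ p → entry p ≡ element v
  location (inj₁ a) with i , (j , Aij) , _ ← paired (suc (toℕ a)) (s≤s z≤n) (s≤s (Finₚ.toℕ<n a)) =
    (i , j) , Aij
  location (inj₂ a) with i , _ , (j , Aij) ← paired (suc (toℕ a)) (s≤s z≤n) (s≤s (Finₚ.toℕ<n a)) =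
    (i , j) , Aij

  locate : Fin N ⊎ Fin N → Fin m × Fin n
  locate = proj₁ ∘ location

  locate-injective : Injective _≡_ _≡_ locate
  locate-injective {v} {w} eq = element-injective {v} {w} (begin
    element v          ≡⟨ sym (proj₂ (location v)) ⟩
    entry (locate v)   ≡⟨ cong entry eq ⟩
    entry (locate w)   ≡⟨ proj₂ (location w) ⟩
    element w          ∎)

  index : Fin m × Fin n → Fin (N + N)
  index (i , j) = Fin.cast size (combine i j)

  index-injective : Injective _≡_ _≡_ index
  index-injective {i , j} {k , l} eq
    with refl , refl ← Finₚ.combine-injective i j k l (Finₚ.toℕ-injective (begin
      toℕ (combine i j)            ≡⟨ Finₚ.toℕ-cast size (combine i j) ⟨
      toℕ (index (i , j))          ≡⟨ cong toℕ eq ⟩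
      toℕ (index (k , l))          ≡⟨ Finₚ.toℕ-cast size (combine k l) ⟩
      toℕ (combine k l)            ∎))
    = refl

  relabel : Fin (N + N) → Fin (N + N)
  relabel = index ∘ locate ∘ splitAt N

  relabel-injective : Injective _≡_ _≡_ relabel
  relabel-injective {e} {e′} eq = begin
    e                           ≡⟨ Finₚ.join-splitAt N N e ⟨
    Fin.join N N (splitAt N e)  ≡⟨ cong (Fin.join N N) same-element ⟩
    Fin.join N N (splitAt N e′) ≡⟨ Finₚ.join-splitAt N N e′ ⟩
    e′                          ∎
    where
    same-element : splitAt N e ≡ splitAt N e′
    same-element = locate-injective {splitAt N e} {splitAt N e′}
                     (index-injective {locate (splitAt N e)} {locate (splitAt N e′)} eq)

  locate-surjective : ∀ p → ∃ λ v → locate v ≡ p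
  locate-surjective p with e , eq ← injective⇒surjective relabel relabel-injective (index p) =
    splitAt N e , index-injective eq

  entries-in-X : ∀ i j → InX N (A i j)
  entries-in-X i j with v , refl ← locate-surjective (i , j) =
    subst (InX N) (sym (proj₂ (location v))) (element-in-X v)

  entries-distinct : Injective _≡_ _≡_ entry
  entries-distinct {p} {q} eq with v , refl ← locate-surjective p | w , refl ← locate-surjective q =
    cong locate (element-injective {v} {w}
      (trans (sym (proj₂ (location v))) (trans eq (proj₂ (location w)))))

  elements-appear : ∀ z → InX N z → ∃[ i ] ∃[ j ] A i j ≡ z
  elements-appear (+ zero) (z≢0 , _) = ⊥-elim (z≢0 refl)
  elements-appear (+ suc x) (_ , x<N) with i , (j , Aij) , _ ← paired (suc x) (s≤s z≤n) (s≤s x<N) =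
    i , j , Aij
  elements-appear ℤ.-[1+ x ] (_ , x<N) with i , _ , (j , Aij) ← paired (suc x) (s≤s z≤n) (s≤s x<N) =
    i , j , Aij

half-of-double : ∀ N → (N + N) / 2 ≡ N
half-of-double N = trans (cong (_/ 2) (double N)) (m*n/n≡m N 2)
  where
  double : ∀ m → m + m ≡ m * 2
  double = solve-∀

PairedSMA : ℕ → ℕ → Set
PairedSMA m n = ∃[ A ] (IsSMA m n A × (∀ x → 1 ≤ x → x ≤ (m * n) / 2 → Paired A x))

paired⇒PairedSMA : ∀ {m n N} (A : Array m n) → AllPaired A N → m * n ≡ N + N →
  (∀ i → sumℤ (λ j → A i j) ≡ 0ℤ) → (∀ j → sumℤ (λ i → A i j) ≡ 0ℤ) → PairedSMA m n
paired⇒PairedSMA {m} {n} {N} A paired size row-sums col-sums =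
  A , sma , λ x 1≤x x≤N → paired x 1≤x (s≤s (subst (x ≤_) half x≤N))
  where
  open Pigeonhole A size paired
  half : (m * n) / 2 ≡ N
  half = trans (cong (_/ 2) size) (half-of-double N)
  sma : IsSMA m n A
  sma = record
    { entries-in-X = λ i j → subst (λ K → InX K (A i j)) (sym half) (entries-in-X i j)
    ; each-once    = entries-distinct
    ; all-appear   = λ z z∈X → elements-appear z (subst (λ K → InX K z) half z∈X)
    ; row-sums     = row-sums
    ; col-sums     = col-sums
    }

even-or-odd : ∀ t → ∃ λ i → t ≡ i + i ⊎ t ≡ suc (i + i)
even-or-odd zero = 0 , inj₁ refl
even-or-odd (suc t) with even-or-odd t
... | i , inj₁ refl = i , inj₂ refl
... | i , inj₂ refl = suc i , inj₁ (cong suc (sym (ℕₚ.+-suc i i)))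

m+m<n+n⇒m<n : ∀ {m n} → m + m < n + n → m < n
m+m<n+n⇒m<n lt = ℕₚ.≰⇒> (λ n≤m → ℕₚ.<⇒≱ lt (ℕₚ.+-mono-≤ n≤m n≤m))

module Cover (P : ℕ → Set) where

  infixr 4 _⟫_

  _⟫_ : ∀ {lo mid hi} → Holds-on P lo mid → Holds-on P mid hi → Holds-on P lo hi
  _⟫_ {mid = mid} below above x lo≤x x<hi with x ℕ.<? mid
  ... | yes x<mid = below x lo≤x x<mid
  ... | no x≮mid = above x (ℕₚ.≮⇒≥ x≮mid) x<hi

  block : ∀ lo hi {ℓ} → (∀ t → t < ℓ → P (lo + t)) → lo + ℓ ≡ hi → Holds-on P lo hi
  block lo _ p refl x lo≤x x<hi with t , refl ← ℕₚ.m≤n⇒∃[o]m+o≡n lo≤x =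
    p t (ℕₚ.+-cancelˡ-< lo t _ x<hi)

  point : ∀ x hi → P x → suc x ≡ hi → Holds-on P x hi
  point x _ p refl y x≤y y<1+x = subst P (ℕₚ.≤-antisym x≤y (ℕ.s≤s⁻¹ y<1+x)) p

  interleave : ∀ o o′ {ℓ} → suc o ≡ o′ →
    (∀ i → i < ℓ → P (o + (i + i))) → (∀ i → i < ℓ → P (o′ + (i + i))) → ∀ t → t < ℓ + ℓ → P (o + t)
  interleave o _ refl evens odds t t<2ℓ with even-or-odd t
  ... | i , inj₁ refl = evens i (m+m<n+n⇒m<n t<2ℓ)
  ... | i , inj₂ refl = subst P (sym (ℕₚ.+-suc o (i + i))) (odds i (m+m<n+n⇒m<n (ℕₚ.<⇒≤ t<2ℓ)))

module Layout {k : ℕ} (M : ℕ) (G : ℕ → ℕ → Fin 4 → Fin 5 → Entry) (T : Fin k → Fin 5 → Entry) where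

  group-at : Fin M → Fin 4 → Fin 5 → Entry
  group-at t = G (toℕ t) (M ∸ toℕ t)

  column : Fin (M * 4 + k) → Fin 5 → Entry
  column = [ uncurry group-at ∘ remQuot 4 , T ]′ ∘ splitAt (M * 4)

  array : Array 5 (M * 4 + k)
  array r c = ⟦ column c r ⟧

  column-group : ∀ t q → column (combine t q ↑ˡ k) ≡ group-at t q
  column-group t q =
    trans (cong [ uncurry group-at ∘ remQuot 4 , T ]′ (Finₚ.splitAt-↑ˡ (M * 4) (combine t q) k))
          (cong (uncurry group-at) (Finₚ.remQuot-combine t q))

  column-tail : ∀ e → column (M * 4 ↑ʳ e) ≡ T e
  column-tail e = cong [ uncurry group-at ∘ remQuot 4 , T ]′ (Finₚ.splitAt-↑ʳ (M * 4) k e)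

  column-sums : (∀ i j → i + j ≡ M → ∀ q → Balanced (G i j q)) → (∀ e → Balanced (T e)) →
    ∀ c → sumℤ (λ r → array r c) ≡ 0ℤ
  column-sums G-balanced T-balanced c = balanced⇒sumℤ≡0 {v = column c} (column-balanced c)
    where
    column-balanced : ∀ c → Balanced (column c)
    column-balanced c with splitAt (M * 4) c
    ... | inj₂ e = T-balanced e
    ... | inj₁ c′ = group-balanced (remQuot 4 c′)
      where
      group-balanced : ∀ p → Balanced (uncurry group-at p)
      group-balanced (t , q) =
        G-balanced (toℕ t) (M ∸ toℕ t) (ℕₚ.m+[n∸m]≡n (ℕₚ.<⇒≤ (Finₚ.toℕ<n t))) q

  row-sums : (∀ i j r → Balanced (λ q → G i j q r)) → (∀ r → Balanced (λ e → T e r)) →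
    ∀ r → sumℤ (λ c → array r c) ≡ 0ℤ
  row-sums G-balanced T-balanced r = begin
    sumℤ (λ c → array r c)
      ≡⟨ sumℤ-↑ (M * 4) (λ c → array r c) ⟩
    sumℤ (λ c → array r (c ↑ˡ k)) ℤ.+ sumℤ (λ e → array r (M * 4 ↑ʳ e))
      ≡⟨ cong₂ ℤ._+_ groups-sum tail-sum ⟩
    0ℤ ∎
    where
    group-sum : ∀ t → sumℤ (λ q → array r (combine t q ↑ˡ k)) ≡ 0ℤ
    group-sum t = trans (sum-cong-≗ (λ q → cong (λ col → ⟦ col r ⟧) (column-group t q)))
                     (balanced⇒sumℤ≡0 {v = λ q → group-at t q r} (G-balanced _ _ r))
    groups-sum : sumℤ (λ c → array r (c ↑ˡ k)) ≡ 0ℤ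
    groups-sum = begin
      sumℤ (λ c → array r (c ↑ˡ k))                                  ≡⟨ sumℤ-combine M _ ⟩
      sumℤ (λ (t : Fin M) → sumℤ (λ q → array r (combine t q ↑ˡ k))) ≡⟨ sum-cong-≗ group-sum ⟩
      sumℤ {M} (λ _ → 0ℤ)                                            ≡⟨ sum-replicate-zero M ⟩
      0ℤ                                                             ∎
    tail-sum : sumℤ (λ e → array r (M * 4 ↑ʳ e)) ≡ 0ℤ
    tail-sum = trans (sum-cong-≗ (λ e → cong (λ col → ⟦ col r ⟧) (column-tail e)))
                     (balanced⇒sumℤ≡0 {v = λ e → T e r} (T-balanced r))

  cell-paired : ∀ {x} r c₁ c₂ → column c₁ r ≡ ⊕ x → column c₂ r ≡ ⊖ x → Paired array x
  cell-paired r c₁ c₂ eq₁ eq₂ = r , (c₁ , cong ⟦_⟧ eq₁) , (c₂ , cong ⟦_⟧ eq₂)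

  group-paired : ∀ {x} t r q₁ q₂ → group-at t q₁ r ≡ ⊕ x → group-at t q₂ r ≡ ⊖ x → Paired array x
  group-paired t r q₁ q₂ eq₁ eq₂ = cell-paired r (combine t q₁ ↑ˡ k) (combine t q₂ ↑ˡ k)
    (trans (cong (λ col → col r) (column-group t q₁)) eq₁)
    (trans (cong (λ col → col r) (column-group t q₂)) eq₂)

  tail-paired : ∀ {x} r e₁ e₂ → T e₁ r ≡ ⊕ x → T e₂ r ≡ ⊖ x → Paired array x
  tail-paired r e₁ e₂ eq₁ eq₂ = cell-paired r (M * 4 ↑ʳ e₁) (M * 4 ↑ʳ e₂)
    (trans (cong (λ col → col r) (column-tail e₁)) eq₁)
    (trans (cong (λ col → col r) (column-tail e₂)) eq₂)

  rising : ∀ r q₁ q₂ (μ : ℕ → ℕ) → (∀ i j → G i j q₁ r ≡ ⊕ μ i × G i j q₂ r ≡ ⊖ μ i) →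
    Paired array (μ M) → ∀ t → t < suc M → Paired array (μ t)
  rising r q₁ q₂ μ cells last t t<1+M with ℕₚ.m≤n⇒m<n∨m≡n (ℕ.s≤s⁻¹ t<1+M)
  ... | inj₂ refl = last
  ... | inj₁ t<M = subst (Paired array ∘ μ) (Finₚ.toℕ-fromℕ< t<M)
                     (uncurry (group-paired (Fin.fromℕ< t<M) r q₁ q₂) (cells _ _))

  falling : ∀ r q₁ q₂ (μ : ℕ → ℕ) → (∀ i j → G i j q₁ r ≡ ⊕ μ j × G i j q₂ r ≡ ⊖ μ j) →
    Paired array (μ 0) → ∀ t → t < suc M → Paired array (μ t)
  falling r q₁ q₂ μ cells first zero _ = first
  falling r q₁ q₂ μ cells first (suc s) 1+s<1+M =
    subst (Paired array ∘ μ) (trans (cong (M ∸_) (Finₚ.toℕ-fromℕ< i<M)) (ℕₚ.m∸[m∸n]≡n 1+s≤M))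
      (uncurry (group-paired (Fin.fromℕ< i<M) r q₁ q₂) (cells _ _))
    where
    1+s≤M : suc s ≤ M
    1+s≤M = ℕ.s≤s⁻¹ 1+s<1+M
    i<M : M ∸ suc s < M
    i<M = ℕₚ.∸-monoʳ-< (s≤s z≤n) 1+s≤M

pair-comm : ∀ x y → x + (y + 0) ≡ y + (x + 0)
pair-comm = solve-∀

module Pattern (M a b c d d′ e f g h k : ℕ) where

  group : ℕ → ℕ → Fin 4 → Fin 5 → Entry
  group i j 0F 0F = ⊖ (d + (i + i))
  group i j 0F 1F = ⊖ (a + i)
  group i j 0F 2F = ⊕ (f + i)
  group i j 0F 3F = ⊕ (g + i)
  group i j 0F 4F = ⊖ (k + j)
  group i j 1F 0F = ⊕ (d + (i + i))
  group i j 1F 1F = ⊕ (b + i)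
  group i j 1F 2F = ⊖ (h + i)
  group i j 1F 3F = ⊕ (e + j)
  group i j 1F 4F = ⊖ (c + i)
  group i j 2F 0F = ⊖ (d′ + (i + i))
  group i j 2F 1F = ⊕ (a + i)
  group i j 2F 2F = ⊕ (h + i)
  group i j 2F 3F = ⊖ (g + i)
  group i j 2F 4F = ⊕ (c + i)
  group i j 3F 0F = ⊕ (d′ + (i + i))
  group i j 3F 1F = ⊖ (b + i)
  group i j 3F 2F = ⊖ (f + i)
  group i j 3F 3F = ⊖ (e + j)
  group i j 3F 4F = ⊕ (k + j)

  group-row-balanced : ∀ i j r → Balanced (λ q → group i j q r)
  group-row-balanced i j 0F = refl
  group-row-balanced i j 1F = pair-comm (b + i) (a + i)
  group-row-balanced i j 2F = pair-comm (f + i) (h + i)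
  group-row-balanced i j 3F = refl
  group-row-balanced i j 4F = pair-comm (c + i) (k + j)

  module _ (column₀ : f + g ≡ a + d + k + M) (column₁ : b + d + e + M ≡ c + h)
           (column₂ : a + c + h ≡ d′ + g) (column₃ : d′ + k ≡ b + e + f) where

    group-column-balanced : ∀ i j → i + j ≡ M → ∀ q → Balanced (group i j q)
    group-column-balanced i j i+j≡M 0F = begin
      (f + i) + ((g + i) + 0)                    ≡⟨ solve (f ∷ g ∷ i ∷ []) ⟩
      (f + g) + (i + i)                          ≡⟨ cong (_+ (i + i)) column₀ ⟩
      (a + d + k + M) + (i + i)                  ≡⟨ cong (λ m → a + d + k + m + (i + i)) i+j≡M ⟨
      (a + d + k + (i + j)) + (i + i)            ≡⟨ solve (a ∷ d ∷ k ∷ i ∷ j ∷ []) ⟩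
      (d + (i + i)) + ((a + i) + ((k + j) + 0))  ∎
    group-column-balanced i j i+j≡M 1F = begin
      (d + (i + i)) + ((b + i) + ((e + j) + 0))  ≡⟨ solve (b ∷ d ∷ e ∷ i ∷ j ∷ []) ⟩
      (b + d + e + (i + j)) + (i + i)            ≡⟨ cong (λ m → b + d + e + m + (i + i)) i+j≡M ⟩
      (b + d + e + M) + (i + i)                  ≡⟨ cong (_+ (i + i)) column₁ ⟩
      (c + h) + (i + i)                          ≡⟨ solve (c ∷ h ∷ i ∷ []) ⟩
      (h + i) + ((c + i) + 0)                    ∎
    group-column-balanced i j _ 2F = begin
      (a + i) + ((h + i) + ((c + i) + 0))        ≡⟨ solve (a ∷ c ∷ h ∷ i ∷ []) ⟩
      (a + c + h) + (i + (i + i))                ≡⟨ cong (_+ (i + (i + i))) column₂ ⟩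
      (d′ + g) + (i + (i + i))                   ≡⟨ solve (d′ ∷ g ∷ i ∷ []) ⟩
      (d′ + (i + i)) + ((g + i) + 0)             ∎
    group-column-balanced i j _ 3F = begin
      (d′ + (i + i)) + ((k + j) + 0)             ≡⟨ solve (d′ ∷ k ∷ i ∷ j ∷ []) ⟩
      (d′ + k) + ((i + i) + j)                   ≡⟨ cong (_+ ((i + i) + j)) column₃ ⟩
      (b + e + f) + ((i + i) + j)                ≡⟨ solve (b ∷ e ∷ f ∷ i ∷ j ∷ []) ⟩
      (b + i) + ((f + i) + ((e + j) + 0))        ∎

module Width≡0mod4 (M : ℕ) where

  open Pattern M 1 (M + 2) (2 * M + 3) (3 * M + 4) (3 * M + 5)
                 (5 * M + 6) (6 * M + 7) (7 * M + 8) (8 * M + 9) (9 * M + 10)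
  open Layout M group (group M 0)
  open Cover (Paired array)

  ascending : ∀ r q₁ q₂ (μ : ℕ → ℕ) → (∀ i j → group i j q₁ r ≡ ⊕ μ i × group i j q₂ r ≡ ⊖ μ i) →
    ∀ t → t < suc M → Paired array (μ t)
  ascending r q₁ q₂ μ cells = rising r q₁ q₂ μ cells (uncurry (tail-paired r q₁ q₂) (cells M 0))

  descending : ∀ r q₁ q₂ (μ : ℕ → ℕ) → (∀ i j → group i j q₁ r ≡ ⊕ μ j × group i j q₂ r ≡ ⊖ μ j) →
    ∀ t → t < suc M → Paired array (μ t)
  descending r q₁ q₂ μ cells = falling r q₁ q₂ μ cells (uncurry (tail-paired r q₁ q₂) (cells M 0))

  all-paired : AllPaired array (10 * M + 10)
  all-paired =
    block 1 (M + 2)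
      (ascending 1F 2F 0F (λ t → 1 + t) (λ _ _ → refl , refl)) (solve (M ∷ [])) ⟫
    block (M + 2) (2 * M + 3)
      (ascending 1F 1F 3F (λ t → M + 2 + t) (λ _ _ → refl , refl)) (solve (M ∷ [])) ⟫
    block (2 * M + 3) (3 * M + 4)
      (ascending 4F 2F 1F (λ t → 2 * M + 3 + t) (λ _ _ → refl , refl)) (solve (M ∷ [])) ⟫
    block (3 * M + 4) (5 * M + 6)
      (interleave (3 * M + 4) (3 * M + 5) (solve (M ∷ []))
        (ascending 0F 1F 0F (λ i → 3 * M + 4 + (i + i)) (λ _ _ → refl , refl))
        (ascending 0F 3F 2F (λ i → 3 * M + 5 + (i + i)) (λ _ _ → refl , refl)))
      (solve (M ∷ [])) ⟫
    block (5 * M + 6) (6 * M + 7)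
      (descending 3F 1F 3F (λ t → 5 * M + 6 + t) (λ _ _ → refl , refl)) (solve (M ∷ [])) ⟫
    block (6 * M + 7) (7 * M + 8)
      (ascending 2F 0F 3F (λ t → 6 * M + 7 + t) (λ _ _ → refl , refl)) (solve (M ∷ [])) ⟫
    block (7 * M + 8) (8 * M + 9)
      (ascending 3F 0F 2F (λ t → 7 * M + 8 + t) (λ _ _ → refl , refl)) (solve (M ∷ [])) ⟫
    block (8 * M + 9) (9 * M + 10)
      (ascending 2F 2F 1F (λ t → 8 * M + 9 + t) (λ _ _ → refl , refl)) (solve (M ∷ [])) ⟫
    block (9 * M + 10) (suc (10 * M + 10))
      (descending 4F 3F 0F (λ t → 9 * M + 10 + t) (λ _ _ → refl , refl)) (solve (M ∷ []))

  columns-balanced : ∀ i j → i + j ≡ M → ∀ q → Balanced (group i j q)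
  columns-balanced =
    group-column-balanced (solve (M ∷ [])) (solve (M ∷ [])) (solve (M ∷ [])) (solve (M ∷ []))

  paired-SMA : PairedSMA 5 (M * 4 + 4)
  paired-SMA = paired⇒PairedSMA array all-paired (solve (M ∷ []))
    (row-sums group-row-balanced (group-row-balanced M 0))
    (column-sums columns-balanced (columns-balanced M 0 (ℕₚ.+-identityʳ M)))

module Width≡2mod4 (M : ℕ) where

  open Pattern M 1 (M + 2) (2 * M + 5) (3 * M + 8) (3 * M + 7)
                 (5 * M + 9) (6 * M + 11) (7 * M + 13) (8 * M + 14) (9 * M + 15)

  -- Column 0F is group M 0 0F with the entries −(M + 1), +(8M + 13), −(9M + 15) of rows 1, 3, 4
  -- moved to columns 4F and 5F; the freed cells and the rest of those two columns hold ±x for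
  -- the five magnitudes 2M + 3, 2M + 4, 3M + 6, 6M + 10, 7M + 12 that the offsets skip.
  tail : Fin 6 → Fin 5 → Entry
  tail 0F 0F = ⊖ (3 * M + 8 + (M + M))
  tail 0F 1F = ⊕ (2 * M + 3)
  tail 0F 2F = ⊕ (6 * M + 11 + M)
  tail 0F 3F = ⊖ (6 * M + 10)
  tail 0F 4F = ⊕ (2 * M + 4)
  tail 1F    = group M 0 1F
  tail 2F    = group M 0 2F
  tail 3F    = group M 0 3F
  tail 4F 0F = ⊖ (3 * M + 6)
  tail 4F 1F = ⊖ (1 + M)
  tail 4F 2F = ⊕ (7 * M + 12)
  tail 4F 3F = ⊕ (6 * M + 10)
  tail 4F 4F = ⊖ (9 * M + 15)
  tail 5F 0F = ⊕ (3 * M + 6)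
  tail 5F 1F = ⊖ (2 * M + 3)
  tail 5F 2F = ⊖ (7 * M + 12)
  tail 5F 3F = ⊕ (8 * M + 13)
  tail 5F 4F = ⊖ (2 * M + 4)

  open Layout M group tail
  open Cover (Paired array)

  columns-balanced : ∀ i j → i + j ≡ M → ∀ q → Balanced (group i j q)
  columns-balanced =
    group-column-balanced (solve (M ∷ [])) (solve (M ∷ [])) (solve (M ∷ [])) (solve (M ∷ []))

  tail-columns-balanced : ∀ e → Balanced (tail e)
  tail-columns-balanced 0F =
    (2 * M + 3) + ((6 * M + 11 + M) + ((2 * M + 4) + 0)) ≡ (3 * M + 8 + (M + M)) + ((6 * M + 10) + 0)
      ∋ solve (M ∷ [])
  tail-columns-balanced 1F = columns-balanced M 0 (ℕₚ.+-identityʳ M) 1F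
  tail-columns-balanced 2F = columns-balanced M 0 (ℕₚ.+-identityʳ M) 2F
  tail-columns-balanced 3F = columns-balanced M 0 (ℕₚ.+-identityʳ M) 3F
  tail-columns-balanced 4F =
    (7 * M + 12) + ((6 * M + 10) + 0) ≡ (3 * M + 6) + ((1 + M) + ((9 * M + 15) + 0))
      ∋ solve (M ∷ [])
  tail-columns-balanced 5F =
    (3 * M + 6) + ((8 * M + 13) + 0) ≡ (2 * M + 3) + ((7 * M + 12) + ((2 * M + 4) + 0))
      ∋ solve (M ∷ [])

  tail-rows-balanced : ∀ r → Balanced (λ e → tail e r)
  tail-rows-balanced 0F = refl
  tail-rows-balanced 1F =
    (2 * M + 3) + ((M + 2 + M) + ((1 + M) + 0)) ≡ (M + 2 + M) + ((1 + M) + ((2 * M + 3) + 0))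
      ∋ solve (M ∷ [])
  tail-rows-balanced 2F =
    (6 * M + 11 + M) + ((8 * M + 14 + M) + ((7 * M + 12) + 0))
      ≡ (8 * M + 14 + M) + ((6 * M + 11 + M) + ((7 * M + 12) + 0))
      ∋ solve (M ∷ [])
  tail-rows-balanced 3F =
    (5 * M + 9 + 0) + ((6 * M + 10) + ((8 * M + 13) + 0))
      ≡ (6 * M + 10) + ((7 * M + 13 + M) + ((5 * M + 9 + 0) + 0))
      ∋ solve (M ∷ [])
  tail-rows-balanced 4F =
    (2 * M + 4) + ((2 * M + 5 + M) + ((9 * M + 15 + 0) + 0))
      ≡ (2 * M + 5 + M) + ((9 * M + 15) + ((2 * M + 4) + 0))
      ∋ solve (M ∷ [])

  all-paired : AllPaired array (10 * M + 15)
  all-paired =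
    block 1 (M + 2)
      (rising 1F 2F 0F (λ t → 1 + t) (λ _ _ → refl , refl) (tail-paired 1F 2F 4F refl refl))
      (solve (M ∷ [])) ⟫
    block (M + 2) (2 * M + 3)
      (rising 1F 1F 3F (λ t → M + 2 + t) (λ _ _ → refl , refl) (tail-paired 1F 1F 3F refl refl))
      (solve (M ∷ [])) ⟫
    point (2 * M + 3) (2 * M + 4) (tail-paired 1F 0F 5F refl refl) (solve (M ∷ [])) ⟫
    point (2 * M + 4) (2 * M + 5) (tail-paired 4F 0F 5F refl refl) (solve (M ∷ [])) ⟫
    block (2 * M + 5) (3 * M + 6)
      (rising 4F 2F 1F (λ t → 2 * M + 5 + t) (λ _ _ → refl , refl) (tail-paired 4F 2F 1F refl refl))
      (solve (M ∷ [])) ⟫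
    point (3 * M + 6) (3 * M + 7) (tail-paired 0F 5F 4F refl refl) (solve (M ∷ [])) ⟫
    block (3 * M + 7) (5 * M + 9)
      (interleave (3 * M + 7) (3 * M + 8) (solve (M ∷ []))
        (rising 0F 3F 2F (λ i → 3 * M + 7 + (i + i)) (λ _ _ → refl , refl) (tail-paired 0F 3F 2F refl refl))
        (rising 0F 1F 0F (λ i → 3 * M + 8 + (i + i)) (λ _ _ → refl , refl) (tail-paired 0F 1F 0F refl refl)))
      (solve (M ∷ [])) ⟫
    block (5 * M + 9) (6 * M + 10)
      (falling 3F 1F 3F (λ t → 5 * M + 9 + t) (λ _ _ → refl , refl) (tail-paired 3F 1F 3F refl refl))
      (solve (M ∷ [])) ⟫
    point (6 * M + 10) (6 * M + 11) (tail-paired 3F 4F 0F refl refl) (solve (M ∷ [])) ⟫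
    block (6 * M + 11) (7 * M + 12)
      (rising 2F 0F 3F (λ t → 6 * M + 11 + t) (λ _ _ → refl , refl) (tail-paired 2F 0F 3F refl refl))
      (solve (M ∷ [])) ⟫
    point (7 * M + 12) (7 * M + 13) (tail-paired 2F 4F 5F refl refl) (solve (M ∷ [])) ⟫
    block (7 * M + 13) (8 * M + 14)
      (rising 3F 0F 2F (λ t → 7 * M + 13 + t) (λ _ _ → refl , refl)
        (tail-paired 3F 5F 2F (cong ⊕_ (8 * M + 13 ≡ 7 * M + 13 + M ∋ solve (M ∷ []))) refl))
      (solve (M ∷ [])) ⟫
    block (8 * M + 14) (9 * M + 15)
      (rising 2F 2F 1F (λ t → 8 * M + 14 + t) (λ _ _ → refl , refl) (tail-paired 2F 2F 1F refl refl))
      (solve (M ∷ [])) ⟫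
    block (9 * M + 15) (suc (10 * M + 15))
      (falling 4F 3F 0F (λ t → 9 * M + 15 + t) (λ _ _ → refl , refl)
        (tail-paired 4F 3F 4F refl (cong ⊖_ (sym (ℕₚ.+-identityʳ (9 * M + 15))))))
      (solve (M ∷ []))

  paired-SMA : PairedSMA 5 (M * 4 + 6)
  paired-SMA = paired⇒PairedSMA array all-paired (solve (M ∷ []))
    (row-sums group-row-balanced tail-rows-balanced)
    (column-sums columns-balanced tail-columns-balanced)

width-cases : ∀ {n} → 4 ≤ n → 2 ∣ n → ∃ λ M → n ≡ M * 4 + 4 ⊎ n ≡ M * 4 + 6
width-cases 4≤n (divides q refl) with even-or-odd q
... | zero  , inj₁ refl = contradiction 4≤n λ ()
... | zero  , inj₂ refl = contradiction 4≤n λ { (s≤s (s≤s ())) }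
... | suc M , inj₁ refl = M , inj₁ (solve (M ∷ []))
... | suc M , inj₂ refl = M , inj₂ (solve (M ∷ []))

lemma3p2 : ∀ (n : ℕ) → 4 ≤ n → 2 ∣ n →
    ∃[ A ] (IsSMA 5 n A × (∀ (x : ℕ) → 1 ≤ x → x ≤ (5 * n) / 2 →
      ∃[ i ] ((∃[ j ] A i j ≡ + x) × (∃[ k ] A i k ≡ - (+ x)))))
lemma3p2 n 4≤n 2∣n with width-cases 4≤n 2∣n
... | M , inj₁ refl = Width≡0mod4.paired-SMA M
... | M , inj₂ refl = Width≡2mod4.paired-SMA M
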